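{- Let $\mathbf A$ be a pseudo-Kleene lattice. Then $\mathbf A$ is sp-orthomodular if and only if $\mathbf A$ has no subalgebra $\mathbf B$ that is isomorphic to $\mathbf B_6$ or to $\mathbf B_8$, and no subalgebra $\mathbf B$ having a congruence $\theta$ with $\mathbf B/\theta$ isomorphic to $\mathbf B_8^{*}$ or to $\mathbf B_{10}$.
   Context: A pseudo-Kleene lattice is an algebra $(A,\land,\lor,{}',0,1)$ where $(A,\land,\lor,0,1)$ is a bounded lattice, ${}'$ is an antitone involution, and $x\land x'\leq y\lor y'$ for all $x,y$. It is sp-orthomodular if for all $x,y$: (SP1) $x\leq y$ and $x'\land y=(x\land x')\lor(y\land y')$ imply $y\land(x\lor x')=x\lor(y\land y')$; (SP2) $x\leq y$ implies $(x\land x')\lor(y\land y')=(x'\land y)\land(x'\land y)'$. The following finite pseudo-Kleene lattices are given by their covering relations (involution maps $0\leftrightarrow 1$ and $u\leftrightarrow u'$). $\mathbf B_6$: elements $0,x,y,y',x',1$ with $0<x<y<1$ and $0<y'<x'<1$ as the only covers. $\mathbf B_8$: elements $0,z',x,y,y',x',z,1$ with covers $0<z'$, $z'<x<y<z$, $z'<y'<x'<z$, $z<1$. $\mathbf B_8^{*}$: elements $0,x,y,z,z',y',x',1$ with covers $0<x$, $0<y$, $x<z$, $z<z'$, $y<z'$, $z<y'$, $z'<x'$, $x'<1$, $y'<1$. $\mathbf B_{10}$: elements $0,a,b,c,p,q,a',b',c',1$ with involution $a\leftrightarrow a'$, $b\leftrightarrow b'$, $c\leftrightarrow c'$, $p\leftrightarrow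 q$, $0\leftrightarrow 1$, and covers $0<a,b,c$; $a<p$, $c<p$, $c<q$, $b<q$; $p<b'$, $p<c'$, $q<c'$, $q<a'$; $a',b',c'<1$. -}

module Defs where

open import Level using (Level; _⊔_; 0ℓ) renaming (suc to lsuc)
open import Algebra.Core using (Op₁; Op₂)
open import Relation.Binary.Core using (Rel)
open import Relation.Binary.Structures using (IsEquivalence)
open import Relation.Binary.PropositionalEquality using (_≡_)
open import Algebra.Lattice.Structures using (IsLattice)
open import Data.Bool using (Bool; true; false; if_then_else_)
open import Data.Product using (Σ; Σ-syntax; _×_; _,_; proj₁; proj₂)
open import Data.Sum using (_⊎_)
open import Relation.Nullary using (¬_)

record PKAlg (c ℓ : Level) : Set (lsuc (c ⊔ ℓ)) where
  infix  4 _≈_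
  infixr 7 _∧_
  infixr 6 _∨_
  infix  8 _′
  infix  4 _≤_
  field
    Carrier : Set c
    _≈_     : Rel Carrier ℓ
    _∧_     : Op₂ Carrier
    _∨_     : Op₂ Carrier
    _′      : Op₁ Carrier
    𝟎       : Carrier
    𝟏       : Carrier

  _≤_ : Rel Carrier ℓ
  x ≤ y = x ∧ y ≈ x

record IsPseudoKleene {c ℓ} (A : PKAlg c ℓ) : Set (c ⊔ ℓ) where
  open PKAlg A
  field
    isLattice   : IsLattice _≈_ _∨_ _∧_
    ′-cong      : ∀ {x y} → x ≈ y → x ′ ≈ y ′
    𝟎-least     : ∀ x → 𝟎 ≤ x
    𝟏-greatest  : ∀ x → x ≤ 𝟏
    antitone    : ∀ {x y} → x ≤ y → y ′ ≤ x ′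
    involutive  : ∀ x → (x ′) ′ ≈ x
    kleene      : ∀ x y → x ∧ x ′ ≤ y ∨ y ′

SP1 : ∀ {c ℓ} → PKAlg c ℓ → Set (c ⊔ ℓ)
SP1 A = ∀ x y → x ≤ y → x ′ ∧ y ≈ (x ∧ x ′) ∨ (y ∧ y ′) →
        y ∧ (x ∨ x ′) ≈ x ∨ (y ∧ y ′)
  where open PKAlg A

SP2 : ∀ {c ℓ} → PKAlg c ℓ → Set (c ⊔ ℓ)
SP2 A = ∀ x y → x ≤ y →
        (x ∧ x ′) ∨ (y ∧ y ′) ≈ (x ′ ∧ y) ∧ (x ′ ∧ y) ′
  where open PKAlg A

SpOrthomodular : ∀ {c ℓ} → PKAlg c ℓ → Set (c ⊔ ℓ)
SpOrthomodular A = SP1 A × SP2 A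

record _≅_ {c₁ ℓ₁ c₂ ℓ₂} (A : PKAlg c₁ ℓ₁) (B : PKAlg c₂ ℓ₂)
       : Set (c₁ ⊔ ℓ₁ ⊔ c₂ ⊔ ℓ₂) where
  private
    module A = PKAlg A
    module B = PKAlg B
  field
    to       : A.Carrier → B.Carrier
    from     : B.Carrier → A.Carrier
    to-cong  : ∀ {x y} → x A.≈ y → to x B.≈ to y
    from-cong : ∀ {x y} → x B.≈ y → from x A.≈ from y
    to-from  : ∀ y → to (from y) B.≈ y
    from-to  : ∀ x → from (to x) A.≈ x
    to-∧     : ∀ x y → to (x A.∧ y) B.≈ to x B.∧ to y
    to-∨     : ∀ x y → to (x A.∨ y) B.≈ to x B.∨ to y
    to-′     : ∀ x → to (x A.′) B.≈ (to x) B.′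
    to-𝟎     : to A.𝟎 B.≈ B.𝟎
    to-𝟏     : to A.𝟏 B.≈ B.𝟏

record Subuniverse {c ℓ} (A : PKAlg c ℓ) : Set (lsuc (c ⊔ ℓ)) where
  open PKAlg A
  field
    S     : Carrier → Set (c ⊔ ℓ)
    S-resp : ∀ {x y} → x ≈ y → S x → S y
    S-∧   : ∀ {x y} → S x → S y → S (x ∧ y)
    S-∨   : ∀ {x y} → S x → S y → S (x ∨ y)
    S-′   : ∀ {x} → S x → S (x ′)
    S-𝟎   : S 𝟎
    S-𝟏   : S 𝟏

Sub : ∀ {c ℓ} {A : PKAlg c ℓ} → Subuniverse A → PKAlg (c ⊔ ℓ) ℓ
Sub {A = A} U = record
  { Carrier = Σ Carrier S
  ; _≈_     = λ u v → proj₁ u ≈ proj₁ v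
  ; _∧_     = λ u v → (proj₁ u ∧ proj₁ v) , S-∧ (proj₂ u) (proj₂ v)
  ; _∨_     = λ u v → (proj₁ u ∨ proj₁ v) , S-∨ (proj₂ u) (proj₂ v)
  ; _′      = λ u → (proj₁ u ′) , S-′ (proj₂ u)
  ; 𝟎       = 𝟎 , S-𝟎
  ; 𝟏       = 𝟏 , S-𝟏
  }
  where open PKAlg A
        open Subuniverse U

-- Congruences and quotient algebras (the quotient of a setoid algebra
-- by a congruence θ is the same carrier with θ as equality).

record Congruence {c ℓ} (B : PKAlg c ℓ) (ℓ′ : Level) : Set (c ⊔ ℓ ⊔ lsuc ℓ′) where
  open PKAlg B
  field
    θ       : Rel Carrier ℓ′
    isEquiv : IsEquivalence θ
    ≈⊆θ     : ∀ {x y} → x ≈ y → θ x y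
    ∧-comp  : ∀ {x y u v} → θ x y → θ u v → θ (x ∧ u) (y ∧ v)
    ∨-comp  : ∀ {x y u v} → θ x y → θ u v → θ (x ∨ u) (y ∨ v)
    ′-comp  : ∀ {x y} → θ x y → θ (x ′) (y ′)

_/_ : ∀ {c ℓ ℓ′} (B : PKAlg c ℓ) → Congruence B ℓ′ → PKAlg c ℓ′
B / Θ = record
  { Carrier = Carrier ; _≈_ = θ ; _∧_ = _∧_ ; _∨_ = _∨_ ; _′ = _′ ; 𝟎 = 𝟎 ; 𝟏 = 𝟏 }
  where open PKAlg B
        open Congruence Θ

-- The finite pseudo-Kleene lattices B₆, B₈, B₈*, B₁₀ (equality ≡).
-- Names: o = 0, i = 1, u' = the involute of u.

module B6 where
  data E : Set where
    o x y y' x' i : E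

  inv : E → E
  inv o = i
  inv x = x'
  inv y = y'
  inv y' = y
  inv x' = x
  inv i = o

  _≤ᵇ_ : E → E → Bool
  o ≤ᵇ o = true
  o ≤ᵇ x = true
  o ≤ᵇ y = true
  o ≤ᵇ y' = true
  o ≤ᵇ x' = true
  o ≤ᵇ i = true
  x ≤ᵇ x = true
  x ≤ᵇ y = true
  x ≤ᵇ i = true
  y ≤ᵇ y = true
  y ≤ᵇ i = true
  y' ≤ᵇ y' = true
  y' ≤ᵇ x' = true
  y' ≤ᵇ i = true
  x' ≤ᵇ x' = true
  x' ≤ᵇ i = true
  i ≤ᵇ i = true
  _ ≤ᵇ _ = false

  glb lub : E → E → E
  glb x y' = o
  glb x x' = o
  glb y y' = o
  glb y x' = o
  glb y' x = o
  glb y' y = o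
  glb x' x = o
  glb x' y = o
  glb _ _ = o   -- never used (comparable pairs)
  lub x y' = i
  lub x x' = i
  lub y y' = i
  lub y x' = i
  lub y' x = i
  lub y' y = i
  lub x' x = i
  lub x' y = i
  lub _ _ = i   -- never used (comparable pairs)

  meet join : E → E → E
  meet u v = if u ≤ᵇ v then u else (if v ≤ᵇ u then v else glb u v)
  join u v = if u ≤ᵇ v then v else (if v ≤ᵇ u then u else lub u v)

  alg : PKAlg 0ℓ 0ℓ
  alg = record { Carrier = E ; _≈_ = _≡_ ; _∧_ = meet ; _∨_ = join ; _′ = inv ; 𝟎 = o ; 𝟏 = i }

module B8 where
  data E : Set where
    o z' x y y' x' z i : E

  inv : E → E
  inv o = i
  inv z' = z
  inv x = x'
  inv y = y'
  inv y' = y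
  inv x' = x
  inv z = z'
  inv i = o

  _≤ᵇ_ : E → E → Bool
  o ≤ᵇ o = true
  o ≤ᵇ z' = true
  o ≤ᵇ x = true
  o ≤ᵇ y = true
  o ≤ᵇ y' = true
  o ≤ᵇ x' = true
  o ≤ᵇ z = true
  o ≤ᵇ i = true
  z' ≤ᵇ z' = true
  z' ≤ᵇ x = true
  z' ≤ᵇ y = true
  z' ≤ᵇ y' = true
  z' ≤ᵇ x' = true
  z' ≤ᵇ z = true
  z' ≤ᵇ i = true
  x ≤ᵇ x = true
  x ≤ᵇ y = true
  x ≤ᵇ z = true
  x ≤ᵇ i = true
  y ≤ᵇ y = true
  y ≤ᵇ z = true
  y ≤ᵇ i = true
  y' ≤ᵇ y' = true
  y' ≤ᵇ x' = true
  y' ≤ᵇ z = true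
  y' ≤ᵇ i = true
  x' ≤ᵇ x' = true
  x' ≤ᵇ z = true
  x' ≤ᵇ i = true
  z ≤ᵇ z = true
  z ≤ᵇ i = true
  i ≤ᵇ i = true
  _ ≤ᵇ _ = false

  glb lub : E → E → E
  glb x y' = z'
  glb x x' = z'
  glb y y' = z'
  glb y x' = z'
  glb y' x = z'
  glb y' y = z'
  glb x' x = z'
  glb x' y = z'
  glb _ _ = o   -- never used (comparable pairs)
  lub x y' = z
  lub x x' = z
  lub y y' = z
  lub y x' = z
  lub y' x = z
  lub y' y = z
  lub x' x = z
  lub x' y = z
  lub _ _ = i   -- never used (comparable pairs)

  meet join : E → E → E
  meet u v = if u ≤ᵇ v then u else (if v ≤ᵇ u then v else glb u v)
  join u v = if u ≤ᵇ v then v else (if v ≤ᵇ u then u else lub u v)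

  alg : PKAlg 0ℓ 0ℓ
  alg = record { Carrier = E ; _≈_ = _≡_ ; _∧_ = meet ; _∨_ = join ; _′ = inv ; 𝟎 = o ; 𝟏 = i }

module B8ˢ where
  data E : Set where
    o x y z z' y' x' i : E

  inv : E → E
  inv o = i
  inv x = x'
  inv y = y'
  inv z = z'
  inv z' = z
  inv y' = y
  inv x' = x
  inv i = o

  _≤ᵇ_ : E → E → Bool
  o ≤ᵇ o = true
  o ≤ᵇ x = true
  o ≤ᵇ y = true
  o ≤ᵇ z = true
  o ≤ᵇ z' = true
  o ≤ᵇ y' = true
  o ≤ᵇ x' = true
  o ≤ᵇ i = true
  x ≤ᵇ x = true
  x ≤ᵇ z = true
  x ≤ᵇ z' = true
  x ≤ᵇ y' = true
  x ≤ᵇ x' = true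
  x ≤ᵇ i = true
  y ≤ᵇ y = true
  y ≤ᵇ z' = true
  y ≤ᵇ x' = true
  y ≤ᵇ i = true
  z ≤ᵇ z = true
  z ≤ᵇ z' = true
  z ≤ᵇ y' = true
  z ≤ᵇ x' = true
  z ≤ᵇ i = true
  z' ≤ᵇ z' = true
  z' ≤ᵇ x' = true
  z' ≤ᵇ i = true
  y' ≤ᵇ y' = true
  y' ≤ᵇ i = true
  x' ≤ᵇ x' = true
  x' ≤ᵇ i = true
  i ≤ᵇ i = true
  _ ≤ᵇ _ = false

  glb lub : E → E → E
  glb x y = o
  glb y x = o
  glb y z = o
  glb y y' = o
  glb z y = o
  glb z' y' = z
  glb y' y = o
  glb y' z' = z
  glb y' x' = z
  glb x' y' = z
  glb _ _ = o   -- never used (comparable pairs)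
  lub x y = z'
  lub y x = z'
  lub y z = z'
  lub y y' = i
  lub z y = z'
  lub z' y' = i
  lub y' y = i
  lub y' z' = i
  lub y' x' = i
  lub x' y' = i
  lub _ _ = i   -- never used (comparable pairs)

  meet join : E → E → E
  meet u v = if u ≤ᵇ v then u else (if v ≤ᵇ u then v else glb u v)
  join u v = if u ≤ᵇ v then v else (if v ≤ᵇ u then u else lub u v)

  alg : PKAlg 0ℓ 0ℓ
  alg = record { Carrier = E ; _≈_ = _≡_ ; _∧_ = meet ; _∨_ = join ; _′ = inv ; 𝟎 = o ; 𝟏 = i }

module B10 where
  data E : Set where
    o a b c p q a' b' c' i : E

  inv : E → E
  inv o = i
  inv a = a'
  inv b = b'
  inv c = c'
  inv p = q
  inv q = p
  inv a' = a
  inv b' = b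
  inv c' = c
  inv i = o

  _≤ᵇ_ : E → E → Bool
  o ≤ᵇ o = true
  o ≤ᵇ a = true
  o ≤ᵇ b = true
  o ≤ᵇ c = true
  o ≤ᵇ p = true
  o ≤ᵇ q = true
  o ≤ᵇ a' = true
  o ≤ᵇ b' = true
  o ≤ᵇ c' = true
  o ≤ᵇ i = true
  a ≤ᵇ a = true
  a ≤ᵇ p = true
  a ≤ᵇ b' = true
  a ≤ᵇ c' = true
  a ≤ᵇ i = true
  b ≤ᵇ b = true
  b ≤ᵇ q = true
  b ≤ᵇ a' = true
  b ≤ᵇ c' = true
  b ≤ᵇ i = true
  c ≤ᵇ c = true
  c ≤ᵇ p = true
  c ≤ᵇ q = true
  c ≤ᵇ a' = true
  c ≤ᵇ b' = true
  c ≤ᵇ c' = true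
  c ≤ᵇ i = true
  p ≤ᵇ p = true
  p ≤ᵇ b' = true
  p ≤ᵇ c' = true
  p ≤ᵇ i = true
  q ≤ᵇ q = true
  q ≤ᵇ a' = true
  q ≤ᵇ c' = true
  q ≤ᵇ i = true
  a' ≤ᵇ a' = true
  a' ≤ᵇ i = true
  b' ≤ᵇ b' = true
  b' ≤ᵇ i = true
  c' ≤ᵇ c' = true
  c' ≤ᵇ i = true
  i ≤ᵇ i = true
  _ ≤ᵇ _ = false

  glb lub : E → E → E
  glb a b = o
  glb a c = o
  glb a q = o
  glb a a' = o
  glb b a = o
  glb b c = o
  glb b p = o
  glb b b' = o
  glb c a = o
  glb c b = o
  glb p b = o
  glb p q = c
  glb p a' = c
  glb q a = o
  glb q p = c
  glb q b' = c
  glb a' a = o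
  glb a' p = c
  glb a' b' = c
  glb a' c' = q
  glb b' b = o
  glb b' q = c
  glb b' a' = c
  glb b' c' = p
  glb c' a' = q
  glb c' b' = p
  glb _ _ = o   -- never used (comparable pairs)
  lub a b = c'
  lub a c = p
  lub a q = c'
  lub a a' = i
  lub b a = c'
  lub b c = q
  lub b p = c'
  lub b b' = i
  lub c a = p
  lub c b = q
  lub p b = c'
  lub p q = c'
  lub p a' = i
  lub q a = c'
  lub q p = c'
  lub q b' = i
  lub a' a = i
  lub a' p = i
  lub a' b' = i
  lub a' c' = i
  lub b' b = i
  lub b' q = i
  lub b' a' = i
  lub b' c' = i
  lub c' a' = i
  lub c' b' = i
  lub _ _ = i   -- never used (comparable pairs)

  meet join : E → E → E
  meet u v = if u ≤ᵇ v then u else (if v ≤ᵇ u then v else glb u v)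
  join u v = if u ≤ᵇ v then v else (if v ≤ᵇ u then u else lub u v)

  alg : PKAlg 0ℓ 0ℓ
  alg = record { Carrier = E ; _≈_ = _≡_ ; _∧_ = meet ; _∨_ = join ; _′ = inv ; 𝟎 = o ; 𝟏 = i }

HasForbiddenSubalgebra : ∀ {c ℓ} → PKAlg c ℓ → Set (lsuc (c ⊔ ℓ))
HasForbiddenSubalgebra A =
  Σ[ U ∈ Subuniverse A ] (Sub U ≅ B6.alg ⊎ Sub U ≅ B8.alg)

HasForbiddenQuotient : ∀ {c ℓ} → PKAlg c ℓ → Set (lsuc (c ⊔ ℓ))
HasForbiddenQuotient {c} {ℓ} A =
  Σ[ U ∈ Subuniverse A ] Σ[ Θ ∈ Congruence (Sub U) (c ⊔ ℓ) ]
    ((Sub U / Θ) ≅ B8ˢ.alg ⊎ (Sub U / Θ) ≅ B10.alg)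

{-# OPTIONS --safe #-}
-- If A is sp-orthomodular, so is every subalgebra, and (SP2) passes to quotients as well;
-- both identities transfer along isomorphisms, while evaluation shows that B₆ and B₈ violate
-- (SP1) and B₈* and B₁₀ violate (SP2).
--
-- Conversely (classically), let (SP1) fail at x ≤ y. Then x ∨ (y ∧ y′), y ∧ (x ∨ x′) and
-- (x ∧ x′) ∨ (y ∧ y′), with their involutes, 0 and 1, form a subalgebra isomorphic to B₆ if
-- (x ∧ x′) ∨ (y ∧ y′) = 0 and to B₈ otherwise. Let (SP2) fail at x ≤ y. If it also fails at
-- x ∧ x′ ≤ y or at y ∧ y′ ≤ x′, pairs whose smaller element u has u ≤ u′, then a subalgebra
-- containing that pair has B₈* as a quotient; otherwise a subalgebra containing x and y has
-- B₁₀ as a quotient.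
--
-- Each element e of the target algebra is represented by an interval [lo e, hi e] of A, with
-- hi e a term in x and y and lo e = (hi e′)′. The union of the intervals is a subuniverse, and
-- lying in a common interval is a congruence whose quotient is the target algebra. The lattice
-- inequalities this needs are decided by Whitman's algorithm modulo the hypotheses of the
-- case, and distinct intervals are separated by reducing lo e ≤ hi f to the failing identity.
module Submission where

open import Defs
open import Level using (_⊔_; 0ℓ; Lift; lift; lower) renaming (suc to lsuc)
open import Algebra.Core using (Op₁; Op₂)
open import Algebra.Lattice.Bundles using (Lattice)
import Algebra.Lattice.Properties.Lattice as LatticeProperties
open import Axiom.ExcludedMiddle using (ExcludedMiddle)
open import Data.Bool using (Bool; true; false; T) renaming (_∧_ to _∧ᵇ_; _∨_ to _∨ᵇ_)
open import Data.Bool.Properties using (T-∧; T-∨)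
open import Data.Empty using (⊥-elim)
import Data.Fin.Properties as Fin
open import Data.List using (List; []; _∷_; lookup)
open import Data.List.Membership.Propositional using (_∈_)
open import Data.List.Relation.Unary.All as All using (All; []; _∷_)
open import Data.List.Relation.Unary.Any using (here; there; index)
open import Data.List.Relation.Unary.Any.Properties using (lookup-index)
open import Data.Nat using (ℕ; zero; suc)
open import Data.Product using (Σ; _×_; _,_; proj₁; uncurry)
open import Data.Sum using (inj₁; inj₂)
open import Function.Bundles using (_⇔_; mk⇔; Equivalence)
import Relation.Binary.Lattice as OrderLattice
open import Relation.Binary.Definitions using (DecidableEquality)
open import Relation.Binary.PropositionalEquality as ≡ using (_≡_; refl)
open import Relation.Binary.Structures using (IsEquivalence)
open import Relation.Nullary using (¬_; yes; no; ⌊_⌋)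
open import Relation.Nullary.Decidable using (Dec; True; map′; toWitness; T?; decidable-stable)

module PseudoKleeneLattice {c ℓ} (A : PKAlg c ℓ) (pk : IsPseudoKleene A) where
  open PKAlg A public
  open IsPseudoKleene pk public

  lattice : Lattice c ℓ
  lattice = record { isLattice = isLattice }

  open Lattice lattice public using (∧-cong; ∨-cong; isEquivalence)
  open IsEquivalence isEquivalence public
    renaming (refl to ≈-refl; sym to ≈-sym; trans to ≈-trans)

  private
    module O = OrderLattice.Lattice (LatticeProperties.∨-∧-orderTheoreticLattice lattice)

  -- The library orders a lattice by x ≈ x ∧ y, the reverse of the equation defining _≤_.
  ≤-trans : ∀ {x y z} → x ≤ y → y ≤ z → x ≤ z
  ≤-trans p q = ≈-sym (O.trans (≈-sym p) (≈-sym q))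

  ≤-antisym : ∀ {x y} → x ≤ y → y ≤ x → x ≈ y
  ≤-antisym p q = O.antisym (≈-sym p) (≈-sym q)

  ≈⇒≤ : ∀ {x y} → x ≈ y → x ≤ y
  ≈⇒≤ e = ≈-sym (O.reflexive e)

  ≤-refl : ∀ {x} → x ≤ x
  ≤-refl = ≈⇒≤ ≈-refl

  x∧y≤x : ∀ x y → x ∧ y ≤ x
  x∧y≤x x y = ≈-sym (O.x∧y≤x x y)

  x∧y≤y : ∀ x y → x ∧ y ≤ y
  x∧y≤y x y = ≈-sym (O.x∧y≤y x y)

  ∧-greatest : ∀ {x y z} → x ≤ y → x ≤ z → x ≤ y ∧ z
  ∧-greatest p q = ≈-sym (O.∧-greatest (≈-sym p) (≈-sym q))

  x≤x∨y : ∀ x y → x ≤ x ∨ y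
  x≤x∨y x y = ≈-sym (O.x≤x∨y x y)

  y≤x∨y : ∀ x y → y ≤ x ∨ y
  y≤x∨y x y = ≈-sym (O.y≤x∨y x y)

  ∨-least : ∀ {x y z} → x ≤ z → y ≤ z → x ∨ y ≤ z
  ∨-least p q = ≈-sym (O.∨-least (≈-sym p) (≈-sym q))

  ∧-mono : ∀ {x y u v} → x ≤ u → y ≤ v → x ∧ y ≤ u ∧ v
  ∧-mono p q = ∧-greatest (≤-trans (x∧y≤x _ _) p) (≤-trans (x∧y≤y _ _) q)

  ∨-mono : ∀ {x y u v} → x ≤ u → y ≤ v → x ∨ y ≤ u ∨ v
  ∨-mono p q = ∨-least (≤-trans p (x≤x∨y _ _)) (≤-trans q (y≤x∨y _ _))

  swap′ˡ : ∀ {x y} → x ′ ≤ y → y ′ ≤ x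
  swap′ˡ {x} p = ≤-trans (antitone p) (≈⇒≤ (involutive x))

  swap′ʳ : ∀ {x y} → x ≤ y ′ → y ≤ x ′
  swap′ʳ {y = y} p = ≤-trans (≈⇒≤ (≈-sym (involutive y))) (antitone p)

  deMorgan₁ : ∀ x y → (x ∧ y) ′ ≈ x ′ ∨ y ′
  deMorgan₁ x y = ≤-antisym
    (swap′ˡ (∧-greatest (swap′ˡ (x≤x∨y (x ′) (y ′))) (swap′ˡ (y≤x∨y (x ′) (y ′)))))
    (∨-least (antitone (x∧y≤x x y)) (antitone (x∧y≤y x y)))

  deMorgan₂ : ∀ x y → (x ∨ y) ′ ≈ x ′ ∧ y ′
  deMorgan₂ x y = ≤-antisym
    (∧-greatest (antitone (x≤x∨y x y)) (antitone (y≤x∨y x y)))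
    (swap′ʳ (∨-least (swap′ʳ (x∧y≤x (x ′) (y ′))) (swap′ʳ (x∧y≤y (x ′) (y ′)))))

  𝟎′≈𝟏 : 𝟎 ′ ≈ 𝟏
  𝟎′≈𝟏 = ≤-antisym (𝟏-greatest _) (swap′ʳ (𝟎-least _))

  𝟏′≈𝟎 : 𝟏 ′ ≈ 𝟎
  𝟏′≈𝟎 = ≤-antisym (swap′ˡ (𝟏-greatest _)) (𝟎-least _)

  x∧x′-negative : ∀ x → x ∧ x ′ ≤ (x ∧ x ′) ′
  x∧x′-negative x = ≤-trans (x∧y≤y x (x ′)) (antitone (x∧y≤x x (x ′)))

data Var : Set where
  𝕩 𝕪 : Var

infixr 7 _∧ₜ_
infixr 6 _∨ₜ_
infix  8 _′ₜ

data Term : Set where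
  var       : Var → Term
  ⊥ₜ ⊤ₜ     : Term
  _∧ₜ_ _∨ₜ_ : Term → Term → Term
  _′ₜ       : Term → Term

X Y : Term
X = var 𝕩
Y = var 𝕪

sp1-lhs sp1-rhs : Term
sp1-lhs = Y ∧ₜ (X ∨ₜ X ′ₜ)
sp1-rhs = X ∨ₜ (Y ∧ₜ Y ′ₜ)

sp2-lhs sp2-rhs : Term → Term → Term
sp2-lhs p q = (p ∧ₜ p ′ₜ) ∨ₜ (q ∧ₜ q ′ₜ)
sp2-rhs p q = (p ′ₜ ∧ₜ q) ∧ₜ (p ′ₜ ∧ₜ q) ′ₜ

module Evaluation {c ℓ} (Q : PKAlg c ℓ) (x y : PKAlg.Carrier Q) where
  open PKAlg Q

  ⟦_⟧ : Term → Carrier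
  ⟦ var 𝕩 ⟧ = x
  ⟦ var 𝕪 ⟧ = y
  ⟦ ⊥ₜ ⟧ = 𝟎
  ⟦ ⊤ₜ ⟧ = 𝟏
  ⟦ s ∧ₜ t ⟧ = ⟦ s ⟧ ∧ ⟦ t ⟧
  ⟦ s ∨ₜ t ⟧ = ⟦ s ⟧ ∨ ⟦ t ⟧
  ⟦ t ′ₜ ⟧ = ⟦ t ⟧ ′

module _ {c ℓ ℓ′} (B : PKAlg c ℓ) (Θ : Congruence B ℓ′) where
  open PKAlg B
  open Congruence Θ
  open IsEquivalence isEquiv using () renaming (refl to θ-refl)

  ⟦⟧-comp : ∀ {x x′ y y′} → θ x x′ → θ y y′ → ∀ t →
            θ (Evaluation.⟦_⟧ B x y t) (Evaluation.⟦_⟧ B x′ y′ t)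
  ⟦⟧-comp xθx′ yθy′ (var 𝕩) = xθx′
  ⟦⟧-comp xθx′ yθy′ (var 𝕪) = yθy′
  ⟦⟧-comp xθx′ yθy′ ⊥ₜ = θ-refl
  ⟦⟧-comp xθx′ yθy′ ⊤ₜ = θ-refl
  ⟦⟧-comp xθx′ yθy′ (s ∧ₜ t) = ∧-comp (⟦⟧-comp xθx′ yθy′ s) (⟦⟧-comp xθx′ yθy′ t)
  ⟦⟧-comp xθx′ yθy′ (s ∨ₜ t) = ∨-comp (⟦⟧-comp xθx′ yθy′ s) (⟦⟧-comp xθx′ yθy′ t)
  ⟦⟧-comp xθx′ yθy′ (t ′ₜ) = ′-comp (⟦⟧-comp xθx′ yθy′ t)

data Literal : Set where
  bot top : Literal
  pos neg : Var → Literal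

infixr 7 _∧ₙ_
infixr 6 _∨ₙ_

data NF : Set where
  lit       : Literal → NF
  _∧ₙ_ _∨ₙ_ : NF → NF → NF

mutual
  nnf : Term → NF
  nnf (var v) = lit (pos v)
  nnf ⊥ₜ = lit bot
  nnf ⊤ₜ = lit top
  nnf (s ∧ₜ t) = nnf s ∧ₙ nnf t
  nnf (s ∨ₜ t) = nnf s ∨ₙ nnf t
  nnf (t ′ₜ) = nnf′ t

  nnf′ : Term → NF
  nnf′ (var v) = lit (neg v)
  nnf′ ⊥ₜ = lit top
  nnf′ ⊤ₜ = lit bot
  nnf′ (s ∧ₜ t) = nnf′ s ∨ₙ nnf′ t
  nnf′ (s ∨ₜ t) = nnf′ s ∧ₙ nnf′ t
  nnf′ (t ′ₜ) = nnf t

-- The order on literals generated by 0 ≤ a ≤ 1 and the standing assumption x ≤ y.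
var≤ : Var → Var → Bool
var≤ 𝕪 𝕩 = false
var≤ _ _ = true

literal≤ : Literal → Literal → Bool
literal≤ bot _ = true
literal≤ _ top = true
literal≤ (pos v) (pos w) = var≤ v w
literal≤ (neg v) (neg w) = var≤ w v
literal≤ _ _ = false

literals : NF → NF → Bool
literals (lit a) (lit b) = literal≤ a b
literals _ _ = false

-- Whitman's algorithm for lattice inequalities between normal forms, extended by
-- cuts through hypotheses p ≤ q; the fuel bounds the nesting depth of such cuts.
module Whitman (hypotheses : List (Term × Term)) where
  mutual
    leq : ℕ → NF → NF → Bool
    leq k (s₁ ∨ₙ s₂) t = leq k s₁ t ∧ᵇ leq k s₂ t
    leq k (lit a) t = leqʳ k (lit a) t
    leq k (s₁ ∧ₙ s₂) t = leqʳ k (s₁ ∧ₙ s₂) t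

    leqʳ : ℕ → NF → NF → Bool
    leqʳ k s (t₁ ∧ₙ t₂) = leqʳ k s t₁ ∧ᵇ leqʳ k s t₂
    leqʳ k s (lit b) = leqʷ k s (lit b)
    leqʳ k s (t₁ ∨ₙ t₂) = leqʷ k s (t₁ ∨ₙ t₂)

    leqʷ : ℕ → NF → NF → Bool
    leqʷ k s t = literals s t ∨ᵇ (viaMeetand k s t ∨ᵇ (viaJoinand k s t ∨ᵇ viaHypothesis k s t))

    viaMeetand : ℕ → NF → NF → Bool
    viaMeetand k (s₁ ∧ₙ s₂) t = leq k s₁ t ∨ᵇ leq k s₂ t
    viaMeetand k (lit _) t = false
    viaMeetand k (_ ∨ₙ _) t = false

    viaJoinand : ℕ → NF → NF → Bool
    viaJoinand k s (t₁ ∨ₙ t₂) = leq k s t₁ ∨ᵇ leq k s t₂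
    viaJoinand k s (lit _) = false
    viaJoinand k s (_ ∧ₙ _) = false

    viaHypothesis : ℕ → NF → NF → Bool
    viaHypothesis zero s t = false
    viaHypothesis (suc k) s t = viaOneOf k s t hypotheses

    viaOneOf : ℕ → NF → NF → List (Term × Term) → Bool
    viaOneOf k s t [] = false
    viaOneOf k s t ((p , q) ∷ hs) = (leq k s (nnf p) ∧ᵇ leq k (nnf q) t) ∨ᵇ viaOneOf k s t hs

  _⊑[_]_ : Term → ℕ → Term → Bool
  s ⊑[ k ] t = leq k (nnf s) (nnf t)

withDuals : List (Term × Term) → List (Term × Term)
withDuals [] = []
withDuals ((p , q) ∷ hs) = (p , q) ∷ (q ′ₜ , p ′ₜ) ∷ withDuals hs

module TermInequalities {c ℓ} (A : PKAlg c ℓ) (pk : IsPseudoKleene A)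
                        {x y : PKAlg.Carrier A} (x≤y : PKAlg._≤_ A x y) where
  open PseudoKleeneLattice A pk
  open Evaluation A x y public

  infix 4 _≤ₜ_
  _≤ₜ_ : Term → Term → Set ℓ
  s ≤ₜ t = ⟦ s ⟧ ≤ ⟦ t ⟧

  withDuals-holds : ∀ {hs} → All (uncurry _≤ₜ_) hs → All (uncurry _≤ₜ_) (withDuals hs)
  withDuals-holds [] = []
  withDuals-holds (p≤q ∷ hs) = p≤q ∷ antitone p≤q ∷ withDuals-holds hs

  ⟦_⟧ₗ : Literal → Carrier
  ⟦ bot ⟧ₗ = 𝟎
  ⟦ top ⟧ₗ = 𝟏
  ⟦ pos v ⟧ₗ = ⟦ var v ⟧
  ⟦ neg v ⟧ₗ = ⟦ var v ⟧ ′

  ⟦_⟧ₙ : NF → Carrier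
  ⟦ lit a ⟧ₙ = ⟦ a ⟧ₗ
  ⟦ s ∧ₙ t ⟧ₙ = ⟦ s ⟧ₙ ∧ ⟦ t ⟧ₙ
  ⟦ s ∨ₙ t ⟧ₙ = ⟦ s ⟧ₙ ∨ ⟦ t ⟧ₙ

  mutual
    nnf-sound : ∀ t → ⟦ nnf t ⟧ₙ ≈ ⟦ t ⟧
    nnf-sound (var v) = ≈-refl
    nnf-sound ⊥ₜ = ≈-refl
    nnf-sound ⊤ₜ = ≈-refl
    nnf-sound (s ∧ₜ t) = ∧-cong (nnf-sound s) (nnf-sound t)
    nnf-sound (s ∨ₜ t) = ∨-cong (nnf-sound s) (nnf-sound t)
    nnf-sound (t ′ₜ) = nnf′-sound t

    nnf′-sound : ∀ t → ⟦ nnf′ t ⟧ₙ ≈ ⟦ t ⟧ ′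
    nnf′-sound (var v) = ≈-refl
    nnf′-sound ⊥ₜ = ≈-sym 𝟎′≈𝟏
    nnf′-sound ⊤ₜ = ≈-sym 𝟏′≈𝟎
    nnf′-sound (s ∧ₜ t) = ≈-trans (∨-cong (nnf′-sound s) (nnf′-sound t)) (≈-sym (deMorgan₁ ⟦ s ⟧ ⟦ t ⟧))
    nnf′-sound (s ∨ₜ t) = ≈-trans (∧-cong (nnf′-sound s) (nnf′-sound t)) (≈-sym (deMorgan₂ ⟦ s ⟧ ⟦ t ⟧))
    nnf′-sound (t ′ₜ) = ≈-trans (nnf-sound t) (≈-sym (involutive ⟦ t ⟧))

  nnf-≤ : ∀ t → ⟦ nnf t ⟧ₙ ≤ ⟦ t ⟧
  nnf-≤ t = ≈⇒≤ (nnf-sound t)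

  ≤-nnf : ∀ t → ⟦ t ⟧ ≤ ⟦ nnf t ⟧ₙ
  ≤-nnf t = ≈⇒≤ (≈-sym (nnf-sound t))

  var≤-sound : ∀ v w → T (var≤ v w) → ⟦ var v ⟧ ≤ ⟦ var w ⟧
  var≤-sound 𝕩 𝕩 _ = ≤-refl
  var≤-sound 𝕩 𝕪 _ = x≤y
  var≤-sound 𝕪 𝕪 _ = ≤-refl

  literal≤-sound : ∀ a b → T (literal≤ a b) → ⟦ a ⟧ₗ ≤ ⟦ b ⟧ₗ
  literal≤-sound bot b _ = 𝟎-least _
  literal≤-sound top top _ = ≤-refl
  literal≤-sound (pos v) top _ = 𝟏-greatest _
  literal≤-sound (neg v) top _ = 𝟏-greatest _
  literal≤-sound (pos v) (pos w) p = var≤-sound v w p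
  literal≤-sound (neg v) (neg w) p = antitone (var≤-sound w v p)

  literals-sound : ∀ s t → T (literals s t) → ⟦ s ⟧ₙ ≤ ⟦ t ⟧ₙ
  literals-sound (lit a) (lit b) = literal≤-sound a b

  module _ (hypotheses : List (Term × Term)) (holds : All (uncurry _≤ₜ_) hypotheses) where
    open Whitman hypotheses

    mutual
      leq-sound : ∀ k s t → T (leq k s t) → ⟦ s ⟧ₙ ≤ ⟦ t ⟧ₙ
      leq-sound k (s₁ ∨ₙ s₂) t p with Equivalence.to (T-∧ {leq k s₁ t}) p
      ... | p₁ , p₂ = ∨-least (leq-sound k s₁ t p₁) (leq-sound k s₂ t p₂)
      leq-sound k (lit a) t p = leqʳ-sound k (lit a) t p
      leq-sound k (s₁ ∧ₙ s₂) t p = leqʳ-sound k (s₁ ∧ₙ s₂) t p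

      leqʳ-sound : ∀ k s t → T (leqʳ k s t) → ⟦ s ⟧ₙ ≤ ⟦ t ⟧ₙ
      leqʳ-sound k s (t₁ ∧ₙ t₂) p with Equivalence.to (T-∧ {leqʳ k s t₁}) p
      ... | p₁ , p₂ = ∧-greatest (leqʳ-sound k s t₁ p₁) (leqʳ-sound k s t₂ p₂)
      leqʳ-sound k s (lit b) p = leqʷ-sound k s (lit b) p
      leqʳ-sound k s (t₁ ∨ₙ t₂) p = leqʷ-sound k s (t₁ ∨ₙ t₂) p

      leqʷ-sound : ∀ k s t → T (leqʷ k s t) → ⟦ s ⟧ₙ ≤ ⟦ t ⟧ₙ
      leqʷ-sound k s t p with Equivalence.to (T-∨ {literals s t}) p
      ... | inj₁ q = literals-sound s t q
      ... | inj₂ q with Equivalence.to (T-∨ {viaMeetand k s t}) q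
      ...   | inj₁ r = viaMeetand-sound k s t r
      ...   | inj₂ r with Equivalence.to (T-∨ {viaJoinand k s t}) r
      ...     | inj₁ u = viaJoinand-sound k s t u
      ...     | inj₂ u = viaHypothesis-sound k s t u

      viaMeetand-sound : ∀ k s t → T (viaMeetand k s t) → ⟦ s ⟧ₙ ≤ ⟦ t ⟧ₙ
      viaMeetand-sound k (s₁ ∧ₙ s₂) t p with Equivalence.to (T-∨ {leq k s₁ t}) p
      ... | inj₁ q = ≤-trans (x∧y≤x _ _) (leq-sound k s₁ t q)
      ... | inj₂ q = ≤-trans (x∧y≤y _ _) (leq-sound k s₂ t q)

      viaJoinand-sound : ∀ k s t → T (viaJoinand k s t) → ⟦ s ⟧ₙ ≤ ⟦ t ⟧ₙ
      viaJoinand-sound k s (t₁ ∨ₙ t₂) p with Equivalence.to (T-∨ {leq k s t₁}) p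
      ... | inj₁ q = ≤-trans (leq-sound k s t₁ q) (x≤x∨y _ _)
      ... | inj₂ q = ≤-trans (leq-sound k s t₂ q) (y≤x∨y _ _)

      viaHypothesis-sound : ∀ k s t → T (viaHypothesis k s t) → ⟦ s ⟧ₙ ≤ ⟦ t ⟧ₙ
      viaHypothesis-sound (suc k) s t p = viaOneOf-sound k s t hypotheses holds p

      viaOneOf-sound : ∀ k s t hs → All (uncurry _≤ₜ_) hs → T (viaOneOf k s t hs) → ⟦ s ⟧ₙ ≤ ⟦ t ⟧ₙ
      viaOneOf-sound k s t ((p , q) ∷ hs) (p≤q ∷ hs-hold) r
        with Equivalence.to (T-∨ {leq k s (nnf p) ∧ᵇ leq k (nnf q) t}) r
      ... | inj₂ r′ = viaOneOf-sound k s t hs hs-hold r′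
      ... | inj₁ r′ with Equivalence.to (T-∧ {leq k s (nnf p)}) r′
      ...   | s≤p , q≤t = ≤-trans (leq-sound k s (nnf p) s≤p)
                            (≤-trans (nnf-≤ p) (≤-trans p≤q (≤-trans (≤-nnf q) (leq-sound k (nnf q) t q≤t))))

    ⊑-sound : ∀ k s t → T (s ⊑[ k ] t) → s ≤ₜ t
    ⊑-sound k s t p = ≤-trans (≤-nnf s) (≤-trans (leq-sound k (nnf s) (nnf t) p) (nnf-≤ t))

record FiniteAlgebra : Set₁ where
  field
    Carrier    : Set
    _∧_ _∨_    : Op₂ Carrier
    _′         : Op₁ Carrier
    𝟎 𝟏        : Carrier
    elements   : List Carrier
    enumerates : ∀ e → e ∈ elements

  algebra : PKAlg 0ℓ 0ℓ
  algebra = record { Carrier = Carrier ; _≈_ = _≡_ ; _∧_ = _∧_ ; _∨_ = _∨_ ; _′ = _′ ; 𝟎 = 𝟎 ; 𝟏 = 𝟏 }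

  _≟_ : DecidableEquality Carrier
  e ≟ f with index (enumerates e) Fin.≟ index (enumerates f)
  ... | yes same = yes (≡.trans (lookup-index (enumerates e))
                         (≡.trans (≡.cong (lookup elements) same) (≡.sym (lookup-index (enumerates f)))))
  ... | no differ = no λ { refl → differ refl }

  Every : (Carrier → Bool) → Set
  Every p = True (All.all? (λ e → T? (p e)) elements)

  every : ∀ {p} → Every p → ∀ e → T (p e)
  every h e = All.lookup (toWitness h) (enumerates e)

  Every₂ : (Carrier → Carrier → Bool) → Set
  Every₂ p = True (All.all? (λ e → All.all? (λ f → T? (p e f)) elements) elements)

  every₂ : ∀ {p} → Every₂ p → ∀ e f → T (p e f)
  every₂ h e f = All.lookup (All.lookup (toWitness h) (enumerates e)) (enumerates f)

B₆ : FiniteAlgebra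
B₆ = record
  { Carrier = E ; _∧_ = meet ; _∨_ = join ; _′ = inv ; 𝟎 = o ; 𝟏 = i
  ; elements = o ∷ x ∷ y ∷ y' ∷ x' ∷ i ∷ []
  ; enumerates = λ { o → here refl ; x → there (here refl) ; y → there (there (here refl))
                   ; y' → there (there (there (here refl))) ; x' → there (there (there (there (here refl))))
                   ; i → there (there (there (there (there (here refl))))) }
  }
  where open B6

B₈ : FiniteAlgebra
B₈ = record
  { Carrier = E ; _∧_ = meet ; _∨_ = join ; _′ = inv ; 𝟎 = o ; 𝟏 = i
  ; elements = o ∷ z' ∷ x ∷ y ∷ y' ∷ x' ∷ z ∷ i ∷ []
  ; enumerates = λ { o → here refl ; z' → there (here refl) ; x → there (there (here refl))
                   ; y → there (there (there (here refl))) ; y' → there (there (there (there (here refl))))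
                   ; x' → there (there (there (there (there (here refl)))))
                   ; z → there (there (there (there (there (there (here refl))))))
                   ; i → there (there (there (there (there (there (there (here refl))))))) }
  }
  where open B8

B₈* : FiniteAlgebra
B₈* = record
  { Carrier = E ; _∧_ = meet ; _∨_ = join ; _′ = inv ; 𝟎 = o ; 𝟏 = i
  ; elements = o ∷ x ∷ y ∷ z ∷ z' ∷ y' ∷ x' ∷ i ∷ []
  ; enumerates = λ { o → here refl ; x → there (here refl) ; y → there (there (here refl))
                   ; z → there (there (there (here refl))) ; z' → there (there (there (there (here refl))))
                   ; y' → there (there (there (there (there (here refl)))))
                   ; x' → there (there (there (there (there (there (here refl))))))
                   ; i → there (there (there (there (there (there (there (here refl))))))) }
  }
  where open B8ˢ

B₁₀ : FiniteAlgebra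
B₁₀ = record
  { Carrier = E ; _∧_ = meet ; _∨_ = join ; _′ = inv ; 𝟎 = o ; 𝟏 = i
  ; elements = o ∷ a ∷ b ∷ c ∷ p ∷ q ∷ a' ∷ b' ∷ c' ∷ i ∷ []
  ; enumerates = λ { o → here refl ; a → there (here refl) ; b → there (there (here refl))
                   ; c → there (there (there (here refl))) ; p → there (there (there (there (here refl))))
                   ; q → there (there (there (there (there (here refl)))))
                   ; a' → there (there (there (there (there (there (here refl))))))
                   ; b' → there (there (there (there (there (there (there (here refl)))))))
                   ; c' → there (there (there (there (there (there (there (there (here refl))))))))
                   ; i → there (there (there (there (there (there (there (there (there (here refl))))))))) }
  }
  where open B10

B₆-violates-SP1 : ¬ SP1 (FiniteAlgebra.algebra B₆)
B₆-violates-SP1 sp1 with sp1 B6.x B6.y refl refl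
... | ()

B₈-violates-SP1 : ¬ SP1 (FiniteAlgebra.algebra B₈)
B₈-violates-SP1 sp1 with sp1 B8.x B8.y refl refl
... | ()

B₈*-violates-SP2 : ¬ SP2 (FiniteAlgebra.algebra B₈*)
B₈*-violates-SP2 sp2 with sp2 B8ˢ.x B8ˢ.y' refl
... | ()

B₁₀-violates-SP2 : ¬ SP2 (FiniteAlgebra.algebra B₁₀)
B₁₀-violates-SP2 sp2 with sp2 B10.a B10.b' refl
... | ()

module IntervalRepresentation {c ℓ} (A : PKAlg c ℓ) (pk : IsPseudoKleene A) (F : FiniteAlgebra)
                              (lo hi : FiniteAlgebra.Carrier F → PKAlg.Carrier A) where
  open PseudoKleeneLattice A pk
  private module F = FiniteAlgebra F

  record IsIntervalRepresentation : Set ℓ where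
    field
      lo-∧      : ∀ e f → lo (e F.∧ f) ≤ lo e ∧ lo f
      hi-∧      : ∀ e f → hi e ∧ hi f ≤ hi (e F.∧ f)
      lo-∨      : ∀ e f → lo (e F.∨ f) ≤ lo e ∨ lo f
      hi-∨      : ∀ e f → hi e ∨ hi f ≤ hi (e F.∨ f)
      lo-′      : ∀ e → lo (e F.′) ≤ hi e ′
      hi-′      : ∀ e → lo e ′ ≤ hi (e F.′)
      lo≤hi     : ∀ e → lo e ≤ hi e
      lo-𝟎      : lo F.𝟎 ≤ 𝟎
      hi-𝟏      : 𝟏 ≤ hi F.𝟏
      separated : ∀ e f → lo e ≤ hi f → lo f ≤ hi e → e ≡ f

  module _ (R : IsIntervalRepresentation) where
    open IsIntervalRepresentation R

    infix 4 _∈[_]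
    _∈[_] : Carrier → F.Carrier → Set ℓ
    u ∈[ e ] = lo e ≤ u × u ≤ hi e

    ∈-∧ : ∀ {u v e f} → u ∈[ e ] → v ∈[ f ] → u ∧ v ∈[ e F.∧ f ]
    ∈-∧ (l₁ , h₁) (l₂ , h₂) = ≤-trans (lo-∧ _ _) (∧-mono l₁ l₂) , ≤-trans (∧-mono h₁ h₂) (hi-∧ _ _)

    ∈-∨ : ∀ {u v e f} → u ∈[ e ] → v ∈[ f ] → u ∨ v ∈[ e F.∨ f ]
    ∈-∨ (l₁ , h₁) (l₂ , h₂) = ≤-trans (lo-∨ _ _) (∨-mono l₁ l₂) , ≤-trans (∨-mono h₁ h₂) (hi-∨ _ _)

    ∈-′ : ∀ {u e} → u ∈[ e ] → u ′ ∈[ e F.′ ]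
    ∈-′ (l , h) = ≤-trans (lo-′ _) (antitone h) , ≤-trans (antitone l) (hi-′ _)

    ∈-resp : ∀ {u v e} → u ≈ v → u ∈[ e ] → v ∈[ e ]
    ∈-resp u≈v (l , h) = ≤-trans l (≈⇒≤ u≈v) , ≤-trans (≈⇒≤ (≈-sym u≈v)) h

    ∈-unique : ∀ {u v e f} → u ≈ v → u ∈[ e ] → v ∈[ f ] → e ≡ f
    ∈-unique u≈v (l₁ , h₁) (l₂ , h₂) =
      separated _ _ (≤-trans l₁ (≤-trans (≈⇒≤ u≈v) h₂)) (≤-trans l₂ (≤-trans (≈⇒≤ (≈-sym u≈v)) h₁))

    subuniverse : Subuniverse A
    subuniverse = record
      { S      = λ u → Lift c (Σ F.Carrier (u ∈[_]))
      ; S-resp = λ { u≈v (lift (e , u∈e)) → lift (e , ∈-resp u≈v u∈e) }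
      ; S-∧    = λ { (lift (e , u∈e)) (lift (f , v∈f)) → lift (e F.∧ f , ∈-∧ u∈e v∈f) }
      ; S-∨    = λ { (lift (e , u∈e)) (lift (f , v∈f)) → lift (e F.∨ f , ∈-∨ u∈e v∈f) }
      ; S-′    = λ { (lift (e , u∈e)) → lift (e F.′ , ∈-′ u∈e) }
      ; S-𝟎    = lift (F.𝟎 , lo-𝟎 , 𝟎-least _)
      ; S-𝟏    = lift (F.𝟏 , 𝟏-greatest _ , hi-𝟏)
      }

    private module S = PKAlg (Sub subuniverse)

    interval : S.Carrier → F.Carrier
    interval (_ , lift (e , _)) = e

    interval-cong : ∀ {u v} → u S.≈ v → interval u ≡ interval v
    interval-cong {u , lift (_ , u∈e)} {v , lift (_ , v∈f)} u≈v = ∈-unique {u} {v} u≈v u∈e v∈f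

    representative : F.Carrier → S.Carrier
    representative e = lo e , lift (e , ≤-refl , lo≤hi e)

    sameInterval : Congruence (Sub subuniverse) (c ⊔ ℓ)
    sameInterval = record
      { θ       = λ u v → Lift (c ⊔ ℓ) (interval u ≡ interval v)
      ; isEquiv = record
        { refl  = lift refl
        ; sym   = λ p → lift (≡.sym (lower p))
        ; trans = λ p q → lift (≡.trans (lower p) (lower q))
        }
      ; ≈⊆θ    = λ {u} {v} u≈v → lift (interval-cong {u} {v} u≈v)
      ; ∧-comp = λ p q → lift (≡.cong₂ F._∧_ (lower p) (lower q))
      ; ∨-comp = λ p q → lift (≡.cong₂ F._∨_ (lower p) (lower q))
      ; ′-comp = λ p → lift (≡.cong F._′ (lower p))
      }

    quotient≅ : (Sub subuniverse / sameInterval) ≅ F.algebra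
    quotient≅ = record
      { to = interval ; from = representative
      ; to-cong = lower ; from-cong = lift
      ; to-from = λ _ → refl ; from-to = λ _ → lift refl
      ; to-∧ = λ _ _ → refl ; to-∨ = λ _ _ → refl ; to-′ = λ _ → refl
      ; to-𝟎 = refl ; to-𝟏 = refl
      }

    sub≅ : (∀ e → hi e ≤ lo e) → Sub subuniverse ≅ F.algebra
    sub≅ hi≤lo = record
      { to = interval ; from = representative
      ; to-cong = λ {u} {v} → interval-cong {u} {v} ; from-cong = λ { refl → ≈-refl }
      ; to-from = λ _ → refl
      ; from-to = λ { (_ , lift (e , l , h)) → ≤-antisym l (≤-trans h (hi≤lo e)) }
      ; to-∧ = λ _ _ → refl ; to-∨ = λ _ _ → refl ; to-′ = λ _ → refl
      ; to-𝟎 = refl ; to-𝟏 = refl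
      }

data Refutation (E : Set) : Set where
  by-basic  : Refutation E
  by-′      : Refutation E → Refutation E
  by-∧ by-∨ : E → Refutation E → Refutation E

module TermRepresentation {c ℓ} (A : PKAlg c ℓ) (pk : IsPseudoKleene A)
                          {x y : PKAlg.Carrier A} (x≤y : PKAlg._≤_ A x y)
                          (hypotheses : List (Term × Term)) (fuel : ℕ)
                          (F : FiniteAlgebra) (hiT : FiniteAlgebra.Carrier F → Term) where
  open PseudoKleeneLattice A pk
  open TermInequalities A pk x≤y
  open Whitman hypotheses
  private module F = FiniteAlgebra F

  loT : F.Carrier → Term
  loT e = hiT (e F.′) ′ₜ

  infix 4 _⊑_
  _⊑_ : Term → Term → Bool
  s ⊑ t = s ⊑[ fuel ] t

  -- A refutation of lo e ≤ hi f transforms it, using the operations, into an inequality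
  -- lo e₁ ≤ hi f₁ with p ≤ lo e₁ and hi f₁ ≤ q for one of the basic non-inequalities p ≰ q.
  module _ (basics : List (Term × Term)) where
    refutedBy : List (Term × Term) → Term → Term → Bool
    refutedBy [] s t = false
    refutedBy ((p , q) ∷ bs) s t = ((p ⊑ s) ∧ᵇ (t ⊑ q)) ∨ᵇ refutedBy bs s t

    refutes : Refutation F.Carrier → F.Carrier → F.Carrier → Bool
    refutes by-basic e f = refutedBy basics (loT e) (hiT f)
    refutes (by-′ r) e f = refutes r (f F.′) (e F.′)
    refutes (by-∧ g r) e f = refutes r (e F.∧ g) (f F.∧ g)
    refutes (by-∨ g r) e f = refutes r (e F.∨ g) (f F.∨ g)

  -- All fields are closed Boolean checks, so a proof of Verified is found by evaluation.
  record Verified (basics : List (Term × Term))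
                  (refutation : F.Carrier → F.Carrier → Refutation F.Carrier) : Set where
    field
      lo-∧      : F.Every₂ λ e f → loT (e F.∧ f) ⊑ loT e ∧ₜ loT f
      hi-∧      : F.Every₂ λ e f → hiT e ∧ₜ hiT f ⊑ hiT (e F.∧ f)
      lo-∨      : F.Every₂ λ e f → loT (e F.∨ f) ⊑ loT e ∨ₜ loT f
      hi-∨      : F.Every₂ λ e f → hiT e ∨ₜ hiT f ⊑ hiT (e F.∨ f)
      lo-′      : F.Every λ e → loT (e F.′) ⊑ hiT e ′ₜ
      hi-′      : F.Every λ e → loT e ′ₜ ⊑ hiT (e F.′)
      lo≤hi     : F.Every λ e → loT e ⊑ hiT e
      lo-𝟎      : T (loT F.𝟎 ⊑ ⊥ₜ)
      hi-𝟏      : T (⊤ₜ ⊑ hiT F.𝟏)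
      separated : F.Every₂ λ e f →
                    ⌊ e F.≟ f ⌋ ∨ᵇ (refutes basics (refutation e f) e f ∨ᵇ refutes basics (refutation f e) f e)

  Degenerate : Set
  Degenerate = F.Every λ e → hiT e ⊑ loT e

  lo hi : F.Carrier → Carrier
  lo e = ⟦ loT e ⟧
  hi e = ⟦ hiT e ⟧

  open IntervalRepresentation A pk F lo hi public

  module _ (holds : All (uncurry _≤ₜ_) hypotheses)
           {basics : List (Term × Term)} (refuted : All (λ (p , q) → ¬ p ≤ₜ q) basics)
           {refutation : F.Carrier → F.Carrier → Refutation F.Carrier}
           (verified : Verified basics refutation) where
    private module V = Verified verified

    sound : ∀ s t → T (s ⊑ t) → s ≤ₜ t
    sound = ⊑-sound hypotheses holds fuel

    lo-∧ : ∀ e f → lo (e F.∧ f) ≤ lo e ∧ lo f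
    lo-∧ e f = sound (loT (e F.∧ f)) (loT e ∧ₜ loT f) (F.every₂ V.lo-∧ e f)

    hi-∧ : ∀ e f → hi e ∧ hi f ≤ hi (e F.∧ f)
    hi-∧ e f = sound (hiT e ∧ₜ hiT f) (hiT (e F.∧ f)) (F.every₂ V.hi-∧ e f)

    lo-∨ : ∀ e f → lo (e F.∨ f) ≤ lo e ∨ lo f
    lo-∨ e f = sound (loT (e F.∨ f)) (loT e ∨ₜ loT f) (F.every₂ V.lo-∨ e f)

    hi-∨ : ∀ e f → hi e ∨ hi f ≤ hi (e F.∨ f)
    hi-∨ e f = sound (hiT e ∨ₜ hiT f) (hiT (e F.∨ f)) (F.every₂ V.hi-∨ e f)

    lo-′ : ∀ e → lo (e F.′) ≤ hi e ′
    lo-′ e = sound (loT (e F.′)) (hiT e ′ₜ) (F.every V.lo-′ e)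

    hi-′ : ∀ e → lo e ′ ≤ hi (e F.′)
    hi-′ e = sound (loT e ′ₜ) (hiT (e F.′)) (F.every V.hi-′ e)

    lo≤hi : ∀ e → lo e ≤ hi e
    lo≤hi e = sound (loT e) (hiT e) (F.every V.lo≤hi e)

    refutedBy-sound : ∀ bs → All (λ (p , q) → ¬ p ≤ₜ q) bs → ∀ s t → T (refutedBy basics bs s t) → ¬ s ≤ₜ t
    refutedBy-sound ((p , q) ∷ bs) (p≰q ∷ bs-refuted) s t h s≤t
      with Equivalence.to (T-∨ {(p ⊑ s) ∧ᵇ (t ⊑ q)}) h
    ... | inj₂ h′ = refutedBy-sound bs bs-refuted s t h′ s≤t
    ... | inj₁ h′ with Equivalence.to (T-∧ {p ⊑ s}) h′
    ...   | p⊑s , t⊑q = p≰q (≤-trans (sound p s p⊑s) (≤-trans s≤t (sound t q t⊑q)))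

    refutes-sound : ∀ r e f → T (refutes basics r e f) → ¬ lo e ≤ hi f
    refutes-sound by-basic e f h = refutedBy-sound basics refuted (loT e) (hiT f) h
    refutes-sound (by-′ r) e f h le = refutes-sound r (f F.′) (e F.′) h
      (≤-trans (lo-′ f) (≤-trans (antitone le) (hi-′ e)))
    refutes-sound (by-∧ g r) e f h le = refutes-sound r (e F.∧ g) (f F.∧ g) h
      (≤-trans (lo-∧ e g) (≤-trans (∧-mono le (lo≤hi g)) (hi-∧ f g)))
    refutes-sound (by-∨ g r) e f h le = refutes-sound r (e F.∨ g) (f F.∨ g) h
      (≤-trans (lo-∨ e g) (≤-trans (∨-mono le (lo≤hi g)) (hi-∨ f g)))

    separated : ∀ e f → lo e ≤ hi f → lo f ≤ hi e → e ≡ f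
    separated e f e≤f f≤e with Equivalence.to (T-∨ {⌊ e F.≟ f ⌋}) (F.every₂ V.separated e f)
    ... | inj₁ e≡f = toWitness e≡f
    ... | inj₂ h with Equivalence.to (T-∨ {refutes basics (refutation e f) e f}) h
    ...   | inj₁ r = ⊥-elim (refutes-sound (refutation e f) e f r e≤f)
    ...   | inj₂ r = ⊥-elim (refutes-sound (refutation f e) f e r f≤e)

    representation : IsIntervalRepresentation
    representation = record
      { lo-∧ = lo-∧ ; hi-∧ = hi-∧ ; lo-∨ = lo-∨ ; hi-∨ = hi-∨ ; lo-′ = lo-′ ; hi-′ = hi-′
      ; lo≤hi = lo≤hi ; lo-𝟎 = sound (loT F.𝟎) ⊥ₜ V.lo-𝟎 ; hi-𝟏 = sound ⊤ₜ (hiT F.𝟏) V.hi-𝟏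
      ; separated = separated
      }

    degenerate : Degenerate → ∀ e → hi e ≤ lo e
    degenerate d e = sound (hiT e) (loT e) (F.every d e)

module _ where
  open B6

  B₆-hi : E → Term
  B₆-hi o = ⊥ₜ
  B₆-hi x = X ∨ₜ (Y ∧ₜ Y ′ₜ)
  B₆-hi y = Y ∧ₜ (X ∨ₜ X ′ₜ)
  B₆-hi y' = Y ′ₜ ∨ₜ (X ′ₜ ∧ₜ X)
  B₆-hi x' = X ′ₜ ∧ₜ (Y ′ₜ ∨ₜ Y)
  B₆-hi i = ⊤ₜ

  B₆-refutation : E → E → Refutation E
  B₆-refutation x o = by-′ (by-∧ y by-basic)
  B₆-refutation x y' = by-′ (by-∧ y by-basic)
  B₆-refutation x x' = by-∧ x (by-′ (by-∧ y by-basic))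
  B₆-refutation y o = by-basic
  B₆-refutation y x = by-basic
  B₆-refutation y y' = by-∧ y by-basic
  B₆-refutation y x' = by-∧ y by-basic
  B₆-refutation y' o = by-∨ x by-basic
  B₆-refutation y' x = by-∨ x by-basic
  B₆-refutation y' y = by-∧ y' (by-∨ x by-basic)
  B₆-refutation x' o = by-′ by-basic
  B₆-refutation x' x = by-∨ x by-basic
  B₆-refutation x' y = by-′ (by-∨ x by-basic)
  B₆-refutation x' y' = by-′ by-basic
  B₆-refutation i o = by-basic
  B₆-refutation i x = by-basic
  B₆-refutation i y = by-′ (by-∨ x by-basic)
  B₆-refutation i y' = by-′ by-basic
  B₆-refutation i x' = by-∧ y by-basic
  B₆-refutation _ _ = by-basic

module _ where
  open B8

  B₈-hi : E → Term
  B₈-hi o = ⊥ₜ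
  B₈-hi z' = (X ∧ₜ X ′ₜ) ∨ₜ (Y ∧ₜ Y ′ₜ)
  B₈-hi x = X ∨ₜ (Y ∧ₜ Y ′ₜ)
  B₈-hi y = Y ∧ₜ (X ∨ₜ X ′ₜ)
  B₈-hi y' = Y ′ₜ ∨ₜ (X ′ₜ ∧ₜ X)
  B₈-hi x' = X ′ₜ ∧ₜ (Y ′ₜ ∨ₜ Y)
  B₈-hi z = (X ′ₜ ∨ₜ X) ∧ₜ (Y ′ₜ ∨ₜ Y)
  B₈-hi i = ⊤ₜ

  B₈-refutation : E → E → Refutation E
  B₈-refutation z' o = by-basic
  B₈-refutation x o = by-basic
  B₈-refutation x z' = by-′ (by-∧ y by-basic)
  B₈-refutation x y' = by-′ (by-∧ y by-basic)
  B₈-refutation x x' = by-∧ x (by-′ (by-∧ y by-basic))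
  B₈-refutation y o = by-basic
  B₈-refutation y z' = by-basic
  B₈-refutation y x = by-basic
  B₈-refutation y y' = by-∧ y by-basic
  B₈-refutation y x' = by-∧ y by-basic
  B₈-refutation y' o = by-basic
  B₈-refutation y' z' = by-∨ x by-basic
  B₈-refutation y' x = by-∨ x by-basic
  B₈-refutation y' y = by-∧ y' (by-∨ x by-basic)
  B₈-refutation x' o = by-basic
  B₈-refutation x' z' = by-′ by-basic
  B₈-refutation x' x = by-∨ x by-basic
  B₈-refutation x' y = by-′ (by-∨ x by-basic)
  B₈-refutation x' y' = by-′ by-basic
  B₈-refutation z o = by-basic
  B₈-refutation z z' = by-basic
  B₈-refutation z x = by-basic
  B₈-refutation z y = by-′ (by-∨ x by-basic)
  B₈-refutation z y' = by-′ by-basic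
  B₈-refutation z x' = by-∧ y by-basic
  B₈-refutation i o = by-basic
  B₈-refutation i z' = by-basic
  B₈-refutation i x = by-basic
  B₈-refutation i y = by-′ by-basic
  B₈-refutation i y' = by-′ by-basic
  B₈-refutation i x' = by-′ by-basic
  B₈-refutation i z = by-′ by-basic
  B₈-refutation _ _ = by-basic

module _ where
  open B8ˢ

  B₈*-hi : E → Term
  B₈*-hi o = Y ∧ₜ Y ′ₜ
  B₈*-hi x = X ∨ₜ (Y ∧ₜ Y ′ₜ)
  B₈*-hi y = Y ′ₜ
  B₈*-hi z = X ′ₜ ∧ₜ Y
  B₈*-hi z' = Y ′ₜ ∨ₜ (X ′ₜ ∧ₜ Y)
  B₈*-hi y' = Y
  B₈*-hi x' = X ′ₜ
  B₈*-hi i = ⊤ₜ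

  B₈*-refutation : E → E → Refutation E
  B₈*-refutation x o = by-′ (by-∧ y' (by-′ (by-∧ z by-basic)))
  B₈*-refutation x y = by-′ (by-∧ y' (by-′ (by-∧ z by-basic)))
  B₈*-refutation y o = by-∨ x by-basic
  B₈*-refutation y x = by-∨ x by-basic
  B₈*-refutation y z = by-∧ y (by-∨ x by-basic)
  B₈*-refutation y y' = by-∧ y (by-∨ x by-basic)
  B₈*-refutation z o = by-basic
  B₈*-refutation z x = by-basic
  B₈*-refutation z y = by-∧ z by-basic
  B₈*-refutation z' o = by-basic
  B₈*-refutation z' x = by-basic
  B₈*-refutation z' y = by-∧ z by-basic
  B₈*-refutation z' z = by-∧ y (by-∨ x by-basic)
  B₈*-refutation z' y' = by-′ (by-∧ y (by-∨ x by-basic))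
  B₈*-refutation y' o = by-basic
  B₈*-refutation y' x = by-basic
  B₈*-refutation y' y = by-∧ z by-basic
  B₈*-refutation y' z = by-′ (by-∧ z by-basic)
  B₈*-refutation y' z' = by-′ (by-∧ z by-basic)
  B₈*-refutation y' x' = by-∧ y' (by-′ (by-∧ z by-basic))
  B₈*-refutation x' o = by-basic
  B₈*-refutation x' x = by-basic
  B₈*-refutation x' y = by-′ by-basic
  B₈*-refutation x' z = by-′ by-basic
  B₈*-refutation x' z' = by-′ by-basic
  B₈*-refutation x' y' = by-′ (by-∨ x by-basic)
  B₈*-refutation i o = by-basic
  B₈*-refutation i x = by-basic
  B₈*-refutation i y = by-′ by-basic
  B₈*-refutation i z = by-′ by-basic
  B₈*-refutation i z' = by-′ by-basic
  B₈*-refutation i y' = by-′ (by-∨ x by-basic)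
  B₈*-refutation i x' = by-∧ y' (by-′ (by-∧ z by-basic))
  B₈*-refutation _ _ = by-basic

module _ where
  open B10

  B₁₀-hi : E → Term
  B₁₀-hi o = (X ∧ₜ X ′ₜ) ∨ₜ (Y ∧ₜ Y ′ₜ)
  B₁₀-hi a = X ∨ₜ (Y ∧ₜ Y ′ₜ)
  B₁₀-hi b = Y ′ₜ ∨ₜ (X ∧ₜ X ′ₜ)
  B₁₀-hi c = X ′ₜ ∧ₜ Y
  B₁₀-hi p = Y ∧ₜ ((X ′ₜ ∧ₜ Y) ∨ₜ (X ∨ₜ Y ′ₜ))
  B₁₀-hi q = X ′ₜ ∧ₜ ((X ′ₜ ∧ₜ Y) ∨ₜ (X ∨ₜ Y ′ₜ))
  B₁₀-hi a' = X ′ₜ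
  B₁₀-hi b' = Y
  B₁₀-hi c' = (X ′ₜ ∧ₜ Y) ∨ₜ (X ∨ₜ Y ′ₜ)
  B₁₀-hi i = ⊤ₜ

  B₁₀-refutation : E → E → Refutation E
  B₁₀-refutation a o = by-∨ b (by-∧ c by-basic)
  B₁₀-refutation a b = by-∧ a (by-∨ b (by-∧ c by-basic))
  B₁₀-refutation a c = by-∧ a (by-∨ b (by-∧ c by-basic))
  B₁₀-refutation a q = by-∧ a (by-∨ b (by-∧ c by-basic))
  B₁₀-refutation a a' = by-∧ a (by-∨ b (by-∧ c by-basic))
  B₁₀-refutation b o = by-∨ a (by-∧ c by-basic)
  B₁₀-refutation b a = by-∨ a (by-∧ c by-basic)
  B₁₀-refutation b c = by-∧ b (by-∨ a (by-∧ c by-basic))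
  B₁₀-refutation b p = by-∧ b (by-∨ a (by-∧ c by-basic))
  B₁₀-refutation b b' = by-∧ b (by-∨ a (by-∧ c by-basic))
  B₁₀-refutation c o = by-basic
  B₁₀-refutation c a = by-∧ c by-basic
  B₁₀-refutation c b = by-∧ c by-basic
  B₁₀-refutation p o = by-basic
  B₁₀-refutation p a = by-∧ c by-basic
  B₁₀-refutation p b = by-∧ c by-basic
  B₁₀-refutation p c = by-∧ a (by-∨ b (by-∧ c by-basic))
  B₁₀-refutation p q = by-∧ a (by-∨ b (by-∧ c by-basic))
  B₁₀-refutation p a' = by-′ (by-∧ a (by-∨ b (by-∧ c by-basic)))
  B₁₀-refutation q o = by-basic
  B₁₀-refutation q a = by-∧ c by-basic
  B₁₀-refutation q b = by-∧ c by-basic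
  B₁₀-refutation q c = by-∧ b (by-∨ a (by-∧ c by-basic))
  B₁₀-refutation q p = by-∧ b (by-∨ a (by-∧ c by-basic))
  B₁₀-refutation q b' = by-′ (by-∧ b (by-∨ a (by-∧ c by-basic)))
  B₁₀-refutation a' o = by-basic
  B₁₀-refutation a' a = by-∧ c by-basic
  B₁₀-refutation a' b = by-∧ c by-basic
  B₁₀-refutation a' c = by-′ (by-∧ c by-basic)
  B₁₀-refutation a' p = by-′ (by-∧ c by-basic)
  B₁₀-refutation a' q = by-′ (by-∧ c by-basic)
  B₁₀-refutation a' b' = by-′ (by-∨ a (by-∧ c by-basic))
  B₁₀-refutation a' c' = by-′ (by-∧ c by-basic)
  B₁₀-refutation b' o = by-basic
  B₁₀-refutation b' a = by-′ (by-∧ c by-basic)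
  B₁₀-refutation b' b = by-∧ c by-basic
  B₁₀-refutation b' c = by-′ (by-∧ c by-basic)
  B₁₀-refutation b' p = by-′ (by-∧ c by-basic)
  B₁₀-refutation b' q = by-′ (by-∧ c by-basic)
  B₁₀-refutation b' a' = by-′ (by-∧ a (by-∨ b (by-∧ c by-basic)))
  B₁₀-refutation b' c' = by-′ (by-∧ c by-basic)
  B₁₀-refutation c' o = by-basic
  B₁₀-refutation c' a = by-∧ c by-basic
  B₁₀-refutation c' b = by-∧ c by-basic
  B₁₀-refutation c' c = by-∧ a (by-∨ b (by-∧ c by-basic))
  B₁₀-refutation c' p = by-′ (by-∧ b (by-∨ a (by-∧ c by-basic)))
  B₁₀-refutation c' q = by-′ (by-∧ a (by-∨ b (by-∧ c by-basic)))
  B₁₀-refutation c' a' = by-′ (by-∧ a (by-∨ b (by-∧ c by-basic)))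
  B₁₀-refutation c' b' = by-′ (by-∧ b (by-∨ a (by-∧ c by-basic)))
  B₁₀-refutation i o = by-basic
  B₁₀-refutation i a = by-′ by-basic
  B₁₀-refutation i b = by-′ by-basic
  B₁₀-refutation i c = by-′ by-basic
  B₁₀-refutation i p = by-′ by-basic
  B₁₀-refutation i q = by-′ by-basic
  B₁₀-refutation i a' = by-′ (by-∨ b (by-∧ c by-basic))
  B₁₀-refutation i b' = by-′ (by-∨ a (by-∧ c by-basic))
  B₁₀-refutation i c' = by-′ by-basic
  B₁₀-refutation _ _ = by-basic

module ForbiddenConfigurations {c ℓ} (A : PKAlg c ℓ) (pk : IsPseudoKleene A)
                               {x y : PKAlg.Carrier A} (x≤y : PKAlg._≤_ A x y) where
  open PseudoKleeneLattice A pk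
  open TermInequalities A pk x≤y

  sp1-rhs≤lhs : sp1-rhs ≤ₜ sp1-lhs
  sp1-rhs≤lhs = ⊑-sound [] [] 1 sp1-rhs sp1-lhs _

  sp2-lhs≤rhs : sp2-lhs X Y ≤ₜ sp2-rhs X Y
  sp2-lhs≤rhs = ⊑-sound [] [] 1 (sp2-lhs X Y) (sp2-rhs X Y) _

  B₆-subalgebra : x ′ ∧ y ≈ ⟦ sp2-lhs X Y ⟧ → ¬ ⟦ sp1-lhs ⟧ ≈ ⟦ sp1-rhs ⟧ → ⟦ sp2-lhs X Y ⟧ ≈ 𝟎 →
                  HasForbiddenSubalgebra A
  B₆-subalgebra premise fails lhs≈𝟎 = subuniverse R , inj₁ (sub≅ R (degenerate holds refuted verified _))
    where
    hypotheses : List (Term × Term)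
    hypotheses = withDuals ((X ′ₜ ∧ₜ Y , sp2-lhs X Y) ∷ (sp2-lhs X Y , ⊥ₜ) ∷ [])
    holds : All (uncurry _≤ₜ_) hypotheses
    holds = withDuals-holds (≈⇒≤ premise ∷ ≈⇒≤ lhs≈𝟎 ∷ [])
    basics : List (Term × Term)
    basics = (sp1-lhs , sp1-rhs) ∷ []
    refuted : All (λ (p , q) → ¬ p ≤ₜ q) basics
    refuted = (λ lhs≤rhs → fails (≤-antisym lhs≤rhs sp1-rhs≤lhs)) ∷ []
    open TermRepresentation A pk x≤y hypotheses 2 B₆ B₆-hi
    verified : Verified basics B₆-refutation
    verified = _
    R : IsIntervalRepresentation
    R = representation holds refuted verified

  B₈-subalgebra : x ′ ∧ y ≈ ⟦ sp2-lhs X Y ⟧ → ¬ ⟦ sp1-lhs ⟧ ≈ ⟦ sp1-rhs ⟧ → ¬ ⟦ sp2-lhs X Y ⟧ ≈ 𝟎 →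
                  HasForbiddenSubalgebra A
  B₈-subalgebra premise fails lhs≉𝟎 = subuniverse R , inj₂ (sub≅ R (degenerate holds refuted verified _))
    where
    hypotheses : List (Term × Term)
    hypotheses = withDuals ((X ′ₜ ∧ₜ Y , sp2-lhs X Y) ∷ [])
    holds : All (uncurry _≤ₜ_) hypotheses
    holds = withDuals-holds (≈⇒≤ premise ∷ [])
    basics : List (Term × Term)
    basics = (sp1-lhs , sp1-rhs) ∷ (sp2-lhs X Y , ⊥ₜ) ∷ []
    refuted : All (λ (p , q) → ¬ p ≤ₜ q) basics
    refuted = (λ lhs≤rhs → fails (≤-antisym lhs≤rhs sp1-rhs≤lhs))
            ∷ (λ lhs≤𝟎 → lhs≉𝟎 (≤-antisym lhs≤𝟎 (𝟎-least _))) ∷ []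
    open TermRepresentation A pk x≤y hypotheses 1 B₈ B₈-hi
    verified : Verified basics B₈-refutation
    verified = _
    R : IsIntervalRepresentation
    R = representation holds refuted verified

  B₈*-quotient : x ≤ x ′ → ¬ ⟦ sp2-lhs X Y ⟧ ≈ ⟦ sp2-rhs X Y ⟧ → HasForbiddenQuotient A
  B₈*-quotient x≤x′ fails = subuniverse R , sameInterval R , inj₁ (quotient≅ R)
    where
    basics : List (Term × Term)
    basics = (sp2-rhs X Y , sp2-lhs X Y) ∷ []
    refuted : All (λ (p , q) → ¬ p ≤ₜ q) basics
    refuted = (λ rhs≤lhs → fails (≤-antisym sp2-lhs≤rhs rhs≤lhs)) ∷ []
    open TermRepresentation A pk x≤y ((X , X ′ₜ) ∷ []) 1 B₈* B₈*-hi
    verified : Verified basics B₈*-refutation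
    verified = _
    R : IsIntervalRepresentation
    R = representation (x≤x′ ∷ []) refuted verified

  B₁₀-quotient : ⟦ sp2-lhs (X ∧ₜ X ′ₜ) Y ⟧ ≈ ⟦ sp2-rhs (X ∧ₜ X ′ₜ) Y ⟧ →
                 ⟦ sp2-lhs (Y ∧ₜ Y ′ₜ) (X ′ₜ) ⟧ ≈ ⟦ sp2-rhs (Y ∧ₜ Y ′ₜ) (X ′ₜ) ⟧ →
                 ¬ ⟦ sp2-lhs X Y ⟧ ≈ ⟦ sp2-rhs X Y ⟧ → HasForbiddenQuotient A
  B₁₀-quotient holds₁ holds₂ fails = subuniverse R , sameInterval R , inj₂ (quotient≅ R)
    where
    hypotheses : List (Term × Term)
    hypotheses = withDuals ((sp2-rhs (X ∧ₜ X ′ₜ) Y , sp2-lhs (X ∧ₜ X ′ₜ) Y)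
                          ∷ (sp2-rhs (Y ∧ₜ Y ′ₜ) (X ′ₜ) , sp2-lhs (Y ∧ₜ Y ′ₜ) (X ′ₜ)) ∷ [])
    holds : All (uncurry _≤ₜ_) hypotheses
    holds = withDuals-holds (≈⇒≤ (≈-sym holds₁) ∷ ≈⇒≤ (≈-sym holds₂) ∷ [])
    basics : List (Term × Term)
    basics = (sp2-rhs X Y , sp2-lhs X Y) ∷ []
    refuted : All (λ (p , q) → ¬ p ≤ₜ q) basics
    refuted = (λ rhs≤lhs → fails (≤-antisym sp2-lhs≤rhs rhs≤lhs)) ∷ []
    open TermRepresentation A pk x≤y hypotheses 1 B₁₀ B₁₀-hi
    verified : Verified basics B₁₀-refutation
    verified = _
    R : IsIntervalRepresentation
    R = representation holds refuted verified

module Transport {c ℓ} (Q : PKAlg c ℓ) (Q-isEquivalence : IsEquivalence (PKAlg._≈_ Q))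
                 (F : FiniteAlgebra) (φ : Q ≅ FiniteAlgebra.algebra F) where
  open PKAlg Q
  open IsEquivalence Q-isEquivalence
  open _≅_ φ
  private module F = FiniteAlgebra F

  module _ (a b : F.Carrier) where
    open Evaluation Q (from a) (from b) renaming (⟦_⟧ to ⟦_⟧Q)
    open Evaluation F.algebra a b renaming (⟦_⟧ to ⟦_⟧F)

    to-⟦⟧ : ∀ t → to ⟦ t ⟧Q ≡ ⟦ t ⟧F
    to-⟦⟧ (var 𝕩) = to-from a
    to-⟦⟧ (var 𝕪) = to-from b
    to-⟦⟧ ⊥ₜ = to-𝟎
    to-⟦⟧ ⊤ₜ = to-𝟏
    to-⟦⟧ (s ∧ₜ t) = ≡.trans (to-∧ _ _) (≡.cong₂ F._∧_ (to-⟦⟧ s) (to-⟦⟧ t))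
    to-⟦⟧ (s ∨ₜ t) = ≡.trans (to-∨ _ _) (≡.cong₂ F._∨_ (to-⟦⟧ s) (to-⟦⟧ t))
    to-⟦⟧ (t ′ₜ) = ≡.trans (to-′ _) (≡.cong F._′ (to-⟦⟧ t))

    reflect : ∀ s t → ⟦ s ⟧Q ≈ ⟦ t ⟧Q → ⟦ s ⟧F ≡ ⟦ t ⟧F
    reflect s t s≈t = ≡.trans (≡.sym (to-⟦⟧ s)) (≡.trans (to-cong s≈t) (to-⟦⟧ t))

    preserve : ∀ s t → ⟦ s ⟧F ≡ ⟦ t ⟧F → ⟦ s ⟧Q ≈ ⟦ t ⟧Q
    preserve s t s≡t = trans (sym (from-to ⟦ s ⟧Q))
      (trans (from-cong (≡.trans (to-⟦⟧ s) (≡.trans s≡t (≡.sym (to-⟦⟧ t))))) (from-to ⟦ t ⟧Q))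

  SP1-transport : SP1 Q → SP1 F.algebra
  SP1-transport sp1 a b a≤b premise = reflect a b sp1-lhs sp1-rhs
    (sp1 (from a) (from b) (preserve a b (X ∧ₜ Y) X a≤b) (preserve a b (X ′ₜ ∧ₜ Y) (sp2-lhs X Y) premise))

  SP2-transport : SP2 Q → SP2 F.algebra
  SP2-transport sp2 a b a≤b = reflect a b (sp2-lhs X Y) (sp2-rhs X Y)
    (sp2 (from a) (from b) (preserve a b (X ∧ₜ Y) X a≤b))

module SpOrthomodularity {c ℓ} (A : PKAlg c ℓ) (pk : IsPseudoKleene A) where
  open PseudoKleeneLattice A pk
  open ForbiddenConfigurations A pk

  SP2-at : Carrier → Carrier → Set ℓ
  SP2-at u v = (u ∧ u ′) ∨ (v ∧ v ′) ≈ (u ′ ∧ v) ∧ (u ′ ∧ v) ′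

  SP1-sub : SP1 A → (U : Subuniverse A) → SP1 (Sub U)
  SP1-sub sp1 U u v = sp1 (proj₁ u) (proj₁ v)

  -- In the quotient u ≤ v only means u θ u ∧ v, so (SP2) is applied to u ∧ v ≤ v instead.
  SP2-quotient : SP2 A → (U : Subuniverse A) (Θ : Congruence (Sub U) (c ⊔ ℓ)) → SP2 (Sub U / Θ)
  SP2-quotient sp2 U Θ u v u∧vθu =
    θ-trans (⟦⟧-comp (Sub U) Θ (θ-sym u∧vθu) (θ-refl {v}) (sp2-lhs X Y))
      (θ-trans (≈⊆θ (sp2 (proj₁ u ∧ proj₁ v) (proj₁ v) (x∧y≤y _ _)))
               (⟦⟧-comp (Sub U) Θ u∧vθu (θ-refl {v}) (sp2-rhs X Y)))
    where
    open Congruence Θ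
    open IsEquivalence isEquiv renaming (refl to θ-refl; sym to θ-sym; trans to θ-trans)

  Sub-isEquivalence : (U : Subuniverse A) → IsEquivalence (PKAlg._≈_ (Sub U))
  Sub-isEquivalence U = record { refl = ≈-refl ; sym = ≈-sym ; trans = ≈-trans }

  SP⇒¬forbiddenSubalgebra : SpOrthomodular A → ¬ HasForbiddenSubalgebra A
  SP⇒¬forbiddenSubalgebra (sp1 , _) (U , inj₁ φ) =
    B₆-violates-SP1 (Transport.SP1-transport (Sub U) (Sub-isEquivalence U) B₆ φ (SP1-sub sp1 U))
  SP⇒¬forbiddenSubalgebra (sp1 , _) (U , inj₂ φ) =
    B₈-violates-SP1 (Transport.SP1-transport (Sub U) (Sub-isEquivalence U) B₈ φ (SP1-sub sp1 U))

  SP⇒¬forbiddenQuotient : SpOrthomodular A → ¬ HasForbiddenQuotient A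
  SP⇒¬forbiddenQuotient (_ , sp2) (U , Θ , inj₁ φ) =
    B₈*-violates-SP2 (Transport.SP2-transport (Sub U / Θ) (Congruence.isEquiv Θ) B₈* φ (SP2-quotient sp2 U Θ))
  SP⇒¬forbiddenQuotient (_ , sp2) (U , Θ , inj₂ φ) =
    B₁₀-violates-SP2 (Transport.SP2-transport (Sub U / Θ) (Congruence.isEquiv Θ) B₁₀ φ (SP2-quotient sp2 U Θ))

  module _ (em : ExcludedMiddle (lsuc (c ⊔ ℓ))) where
    dec : (P : Set ℓ) → Dec P
    dec P = map′ lower lift (em {Lift (lsuc (c ⊔ ℓ)) P})

    ¬forbidden⇒SP1 : ¬ HasForbiddenSubalgebra A → SP1 A
    ¬forbidden⇒SP1 none x y x≤y premise with dec (y ∧ (x ∨ x ′) ≈ x ∨ (y ∧ y ′))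
    ... | yes holds = holds
    ... | no fails with dec ((x ∧ x ′) ∨ (y ∧ y ′) ≈ 𝟎)
    ...   | yes lhs≈𝟎 = ⊥-elim (none (B₆-subalgebra x≤y premise fails lhs≈𝟎))
    ...   | no lhs≉𝟎 = ⊥-elim (none (B₈-subalgebra x≤y premise fails lhs≉𝟎))

    ¬forbidden⇒SP2 : ¬ HasForbiddenQuotient A → SP2 A
    ¬forbidden⇒SP2 none x y x≤y = decidable-stable (dec (SP2-at x y)) λ fails →
      none (B₁₀-quotient x≤y (SP2-negative (≤-trans (x∧y≤x x (x ′)) x≤y) (x∧x′-negative x))
                             (SP2-negative (≤-trans (x∧y≤y y (y ′)) (antitone x≤y)) (x∧x′-negative y))
                             fails)
      where
      SP2-negative : ∀ {u v} → u ≤ v → u ≤ u ′ → SP2-at u v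
      SP2-negative {u} {v} u≤v u≤u′ =
        decidable-stable (dec (SP2-at u v)) λ fails → none (B₈*-quotient u≤v u≤u′ fails)

theorem4p1 : ∀ {c ℓ} → ExcludedMiddle (lsuc (c ⊔ ℓ)) →
    (A : PKAlg c ℓ) → IsPseudoKleene A →
    SpOrthomodular A ⇔ (¬ HasForbiddenSubalgebra A × ¬ HasForbiddenQuotient A)
theorem4p1 em A pk = mk⇔
  (λ sp → SP⇒¬forbiddenSubalgebra sp , SP⇒¬forbiddenQuotient sp)
  (λ (no-subalgebra , no-quotient) → ¬forbidden⇒SP1 em no-subalgebra , ¬forbidden⇒SP2 em no-quotient)
  where open SpOrthomodularity A pk
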